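{- Let $(E,\mathcal F,\mathcal L)$ be an oriented interval greedoid. Then $\mathcal L|_{\Gamma(\emptyset)}=\{\mathrm{res}_{\Gamma(\emptyset)}(\alpha):\alpha\in\mathcal L\}$ equals $\{\alpha|_{\Gamma(\emptyset)}:\alpha\in\mathcal L\}$, and the restriction $(\Gamma(\emptyset),\mathcal F|_{\Gamma(\emptyset)},\mathcal L|_{\Gamma(\emptyset)})$ is an oriented matroid (that is, $\mathcal L|_{\Gamma(\emptyset)}$ is a set of maps $\Gamma(\emptyset)\to\{0,+,-\}$ forming an oriented matroid).
   Context: Interval greedoid: finite $E$, nonempty family $\mathcal F$ with (IG1) each nonempty $X\in\mathcal F$ has $x$ with $X\setminus\{x\}\in\mathcal F$; (IG2) if $|X|>|Y|$ there is $x\in X\setminus Y$ with $Y\cup\{x\}\in\mathcal F$; (IG3) if $X\subseteq Y\subseteq Z$ in $\mathcal F$, $e\notin Z$, $X\cup\{e\},Z\cup\{e\}\in\mathcal F$, then $Y\cup\{e\}\in\mathcal F$. $\Gamma(X)=\{x\in E\setminus X:X\cup\{x\}\in\mathcal F\}$ (so $\Gamma(\emptyset)=\{x:\{x\}\in\mathcal F\}$); $X\sim Y$ iff $\Gamma(X)=\Gamma(Y)$; classes $[X]$ are flats; $\Phi$ the set of flats ordered by $[X]\le[Y]$ iff there is $Z\subseteq E\setminus Y$ with $Y\cup Z\in\mathcal F$ and $Y\cup Z\sim X$ (a lattice). For a flat $A=[X]$: $\Gamma(A)=\Gamma(X)$, $\xi(A)=\bigcup_{X'\sim X}X'$; $\mu(S)=[X]$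 for $X$ inclusion-maximal feasible in $S$; join $A\vee B=\mu(\xi(A)\cap\xi(B))$. A covector is $\alpha:E\to\{0,+,-,1\}$ such that for some flat $A=\mathrm{supp}(\alpha)$, $\alpha\in\{+,-\}$ on $\Gamma(A)$, $0$ on $\xi(A)$, $1$ elsewhere. Symbols ordered $0<+<1$, $0<-<1$. Product: with $C=\mathrm{supp}\,\alpha\vee\mathrm{supp}\,\beta$, $(\alpha\circ\beta)(e)=\beta(e)$ if $e\in\Gamma(C)\cup\xi(C)$ and $\beta(e)>\alpha(e)$; $\alpha(e)$ if $e\in\Gamma(C)\cup\xi(C)$ otherwise; $1$ otherwise. $-\alpha$ swaps $+,-$; $S(\alpha,\beta)=\{e:\alpha(e)=-\beta(e)\in\{+,-\}\}$. Oriented interval greedoid: $(E,\mathcal F,\mathcal L)$, $\mathcal L$ a set of covectors with (OG1) $\mathrm{supp}:\mathcal L\to\Phi$ surjective; (OG2) $-\mathcal L=\mathcal L$; (OG3) closed under $\circ$; (OG4) if $\alpha,\beta\in\mathcal L$, $x\in S(\alpha,\beta)$, $(\alpha\circ\beta)(x)\ne1$, some $\gamma\in\mathcal L$ has $\gamma(x)=0$ and $\gamma(y)=(\alpha\circ\beta)(y)=(\beta\circ\alpha)(y)$ for all $y\notin S(\alpha,\beta)$ with $(\alpha\circ\beta)(y)\neq1$. Restriction: for $W\subseteq E$, $\mathcal F|_W=\{X\in\mathcal F:X\subseteq W\}$, with its own $\Gamma|_W,\xi|_W,\mu|_W$; for $C\in\Phi$, $C|_W=\mu|_W(W\cap\xi(C))$;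 for a covector $\alpha$ with $A=\mathrm{supp}\,\alpha$, $\mathrm{res}_W(\alpha)$ is $0$ on $\xi|_W(A|_W)$, $\alpha$ on $\Gamma|_W(A|_W)$, $1$ elsewhere on $W$. Oriented matroid on a finite set $E'$: a set $\mathcal M$ of maps $E'\to\{0,+,-\}$ containing the zero map, closed under negation and under $(\alpha\circ\beta)(e)=\alpha(e)$ if $\alpha(e)\ne0$ else $\beta(e)$, and such that for $\alpha,\beta\in\mathcal M$ and $e$ with $\alpha(e)=-\beta(e)\neq0$ there is $\gamma\in\mathcal M$ with $\gamma(e)=0$ and $\gamma(f)=(\alpha\circ\beta)(f)=(\beta\circ\alpha)(f)$ for all $f$ with not $\alpha(f)=-\beta(f)\ne0$. -}

module Defs where

open import Data.Nat using (ℕ; _<_)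
open import Data.Bool using (Bool; true; false; T; if_then_else_)
open import Data.Fin using (Fin)
open import Data.Fin.Subset using (Subset; _∈_; _∉_; _⊆_; _∪_; _-_; ⁅_⁆; ∣_∣; Nonempty)
open import Data.Vec using (Vec; lookup; map)
open import Data.Product using (Σ; ∃; _×_; _,_; proj₁)
open import Data.Sum using (_⊎_)
open import Relation.Nullary using (¬_)
open import Relation.Binary.PropositionalEquality using (_≡_; _≢_)

data Sign : Set where
  zer pos neg one : Sign

data Sign3 : Set where
  zer₃ pos₃ neg₃ : Sign3

negS : Sign → Sign
negS pos = neg
negS neg = pos
negS s   = s

-- gtS a b = true  iff  a > b  in the order 0<+<1, 0<-<1 (+,- incomparable)
gtS : Sign → Sign → Bool
gtS pos zer = true
gtS neg zer = true
gtS one zer = true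
gtS one pos = true
gtS one neg = true
gtS _   _   = false

-- value of the product at a coordinate in Γ(C) ∪ ξ(C):
-- β(e) if β(e) > α(e), otherwise α(e)
combine : Sign → Sign → Sign
combine a b = if gtS b a then b else a

embed : Sign3 → Sign
embed zer₃ = zer
embed pos₃ = pos
embed neg₃ = neg

Family : ℕ → Set₁
Family n = Subset n → Set

module _ {n : ℕ} (Fe : Family n) where

  Γ : Subset n → Fin n → Set
  Γ X x = x ∉ X × Fe (X ∪ ⁅ x ⁆)

  _∼_ : Subset n → Subset n → Set
  X ∼ Y = ∀ x → (Γ X x → Γ Y x) × (Γ Y x → Γ X x)

  ξ : Subset n → Fin n → Set
  ξ X e = Σ (Subset n) λ X' → Fe X' × X' ∼ X × e ∈ X'

  -- X is an inclusion-maximal feasible set contained in S (so μ(S) = [X])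
  MaxIn : (Fin n → Set) → Subset n → Set
  MaxIn S X = Fe X × (∀ e → e ∈ X → S e)
            × (∀ Y → Fe Y → X ⊆ Y → (∀ e → e ∈ Y → S e) → Y ⊆ X)

  IsIntervalGreedoid : Set
  IsIntervalGreedoid =
      (Σ (Subset n) Fe)
    × (∀ X → Fe X → Nonempty X → Σ (Fin n) λ x → x ∈ X × Fe (X - x))
    × (∀ X Y → Fe X → Fe Y → ∣ Y ∣ < ∣ X ∣ →
         Σ (Fin n) λ x → x ∈ X × x ∉ Y × Fe (Y ∪ ⁅ x ⁆))
    × (∀ X Y Z e → Fe X → Fe Y → Fe Z → X ⊆ Y → Y ⊆ Z → e ∉ Z →
         Fe (X ∪ ⁅ e ⁆) → Fe (Z ∪ ⁅ e ⁆) → Fe (Y ∪ ⁅ e ⁆))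

  -- α is a covector with supp α = [X]
  IsCovector : Vec Sign n → Subset n → Set
  IsCovector α X = Fe X × (∀ e →
      (Γ X e → lookup α e ≡ pos ⊎ lookup α e ≡ neg)
    × (ξ X e → lookup α e ≡ zer)
    × (¬ Γ X e → ¬ ξ X e → lookup α e ≡ one))

  -- γ = α ∘ β, where C = supp α ∨ supp β = μ(ξ(supp α) ∩ ξ(supp β)) = [Z]
  IsProduct : Vec Sign n → Vec Sign n → Vec Sign n → Set
  IsProduct α β γ = Σ (Subset n) λ X → Σ (Subset n) λ Y → Σ (Subset n) λ Z →
      IsCovector α X × IsCovector β Y
    × MaxIn (λ e → ξ X e × ξ Y e) Z
    × (∀ e → ((Γ Z e ⊎ ξ Z e) → lookup γ e ≡ combine (lookup α e) (lookup β e))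
           × (¬ (Γ Z e ⊎ ξ Z e) → lookup γ e ≡ one))

  Sep : Vec Sign n → Vec Sign n → Fin n → Set
  Sep α β e = (lookup α e ≡ pos × lookup β e ≡ neg) ⊎ (lookup α e ≡ neg × lookup β e ≡ pos)

  record IsOrientedIntervalGreedoid (L : Vec Sign n → Set) : Set where
    field
      greedoid : IsIntervalGreedoid
      covec    : ∀ α → L α → Σ (Subset n) λ X → IsCovector α X
      OG1      : ∀ X → Fe X → Σ (Vec Sign n) λ α → L α × IsCovector α X
      OG2      : ∀ α → L α → L (map negS α)
      OG3      : ∀ α β γ → L α → L β → IsProduct α β γ → L γ
      OG4      : ∀ α β p q x → L α → L β → IsProduct α β p → IsProduct β α q →
                 Sep α β x → lookup p x ≢ one →
                 Σ (Vec Sign n) λ γ → L γ × lookup γ x ≡ zer ×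
                   (∀ y → ¬ Sep α β y → lookup p y ≢ one →
                      lookup γ y ≡ lookup p y × lookup γ y ≡ lookup q y)

restrictFam : ∀ {n} → Family n → (Fin n → Set) → Family n
restrictFam Fe W X = Fe X × (∀ e → e ∈ X → W e)

-- r = res_W(α): with supp α = [X] and A|W = μ|W(W ∩ ξ(A)) = [Y]_W,
-- r is 0 on ξ|W(A|W), α on Γ|W(A|W), 1 elsewhere on W
IsRes : ∀ {n : ℕ} (Fe : Family n) (W : Fin n → Set) → Vec Sign n → (Σ (Fin n) W → Sign) → Set
IsRes {n} Fe W α r = Σ (Subset n) λ X → Σ (Subset n) λ Y →
    IsCovector Fe α X
  × MaxIn' (λ e → W e × ξ Fe X e) Y
  × (∀ w → (ξ' Y (proj₁ w) → r w ≡ zer)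
         × (Γ' Y (proj₁ w) → r w ≡ lookup α (proj₁ w))
         × (¬ ξ' Y (proj₁ w) → ¬ Γ' Y (proj₁ w) → r w ≡ one))
  where
    MaxIn' = MaxIn (restrictFam Fe W)
    ξ' = ξ (restrictFam Fe W)
    Γ' = Γ (restrictFam Fe W)

ResSet : ∀ {n} (Fe : Family n) (W : Fin n → Set) → (Vec Sign n → Set) → (Σ (Fin n) W → Sign) → Set
ResSet {n} Fe W L r = Σ (Vec Sign n) λ α → L α × IsRes Fe W α r

RestrSet : ∀ {n} (Fe : Family n) (W : Fin n → Set) → (Vec Sign n → Set) → (Σ (Fin n) W → Sign) → Set
RestrSet {n} Fe W L r = Σ (Vec Sign n) λ α → L α × (∀ w → r w ≡ lookup α (proj₁ w))

Γ∅ : ∀ {n} → Family n → Fin n → Set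
Γ∅ Fe x = Fe ⁅ x ⁆

neg₃ˢ : Sign3 → Sign3
neg₃ˢ pos₃ = neg₃
neg₃ˢ neg₃ = pos₃
neg₃ˢ zer₃ = zer₃

comp₃ : Sign3 → Sign3 → Sign3
comp₃ zer₃ b = b
comp₃ a    _ = a

Sep₃ : {E' : Set} → (E' → Sign3) → (E' → Sign3) → E' → Set
Sep₃ α β e = α e ≡ neg₃ˢ (β e) × α e ≢ zer₃

record IsOrientedMatroid (E' : Set) (M : (E' → Sign3) → Set) : Set where
  field
    zero∈ : M (λ _ → zer₃)
    neg∈  : ∀ α → M α → M (λ e → neg₃ˢ (α e))
    comp∈ : ∀ α β → M α → M β → M (λ e → comp₃ (α e) (β e))
    elim  : ∀ α β e → M α → M β → Sep₃ α β e →
            Σ (E' → Sign3) λ γ → M γ × γ e ≡ zer₃ ×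
              (∀ f → ¬ Sep₃ α β f →
                 γ f ≡ comp₃ (α f) (β f) × γ f ≡ comp₃ (β f) (α f))

module Submission where

-- Write W = Γ(∅). The key greedoid fact is that every w ∈ W lies in Γ(X) ∪ ξ(X) for each
-- feasible X: if X ∪ {w} is infeasible, augmenting {w} from X gives a feasible set of the
-- same size as X, inside X ∪ {w}, containing w, and such a set is equivalent to X.  Hence
-- every covector takes only the values 0, + and − on W.  Moreover, if Y is maximal feasible
-- in W ∩ ξ(A), then no element of Γ(A) lies in ξ|W(Y): Y sits inside one member X' of the
-- class A, and IG3 applied to ∅ ⊆ Y ⊆ X' puts such an element into Γ|W(Y).  So res_W(α) is
-- just α|W, and the oriented-matroid axioms of L|W are inherited from OG1–OG4, the greedoid
-- product restricting to the sign composition because W ⊆ Γ(C) ∪ ξ(C) for every flat C.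

open import Defs
open import Data.Nat using (ℕ; zero; suc; _+_; _∸_; _≤_; _<_; _<?_; s≤s; z≤n)
open import Data.Nat.Properties using (+-identityʳ; +-suc; m<m+n; m+[n∸m]≡n; ≮⇒≥; <-irrefl; n<1+n)
open import Data.Bool using (Bool; T; T?)
open import Data.Fin using (Fin; zero; suc; _≟_)
open import Data.Fin.Properties using (any?; all?)
open import Data.Fin.Subset using (Subset; _∈_; _∉_; _⊆_; _⊈_; _⊂_; _⊃_; _∪_; _-_; ⁅_⁆; ∣_∣; Nonempty; inside; outside) renaming (⊥ to ∅)
open import Data.Fin.Subset.Properties using (_∈?_; _⊆?_; _⊂?_; p⊂q⇒∣p∣<∣q∣; ⊆-antisym; ∪-identityʳ; ∪-identityˡ; p⊆p∪q; q⊆p∪q; x∈p∪q⁻; x∈⁅x⁆; x∈⁅y⁆⇒x≡y; x∈p∧x≢y⇒x∈p-y; p─q⊆p; x∈p⇒p-x⊂p; nonempty?; Empty-unique; anySubset?; ∉⊥; ⊥⊆)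
open import Data.Fin.Subset.Induction using (⊂-wellFounded; ⊃-wellFounded; Acc; acc)
open import Data.Vec using (Vec; lookup; map; tabulate; _∷_; here; there)
open import Data.Vec.Properties using (lookup∘tabulate; lookup-map)
open import Data.Product using (Σ; ∃; _×_; _,_; proj₁; proj₂)
open import Data.Sum using (_⊎_; inj₁; inj₂; [_,_]; map₂)
open import Data.Unit using (⊤; tt)
open import Data.Empty using (⊥-elim)
open import Function using (_∘_; _⇔_; mk⇔; Equivalence)
open import Relation.Nullary using (¬_; Dec; yes; no; ¬?)
open import Relation.Nullary.Decidable using (_×-dec_; _⊎-dec_; _→-dec_; decidable-stable)
open import Relation.Binary.PropositionalEquality using (_≡_; _≢_; refl; sym; trans; cong; cong₂; subst; subst₂; module ≡-Reasoning)

∣p∪⁅x⁆∣≡1+∣p∣ : ∀ {n} (p : Subset n) (x : Fin n) → x ∉ p → ∣ p ∪ ⁅ x ⁆ ∣ ≡ suc ∣ p ∣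
∣p∪⁅x⁆∣≡1+∣p∣ (outside ∷ p) zero    _   = cong suc (cong ∣_∣ (∪-identityʳ p))
∣p∪⁅x⁆∣≡1+∣p∣ (inside  ∷ p) zero    x∉p = ⊥-elim (x∉p here)
∣p∪⁅x⁆∣≡1+∣p∣ (outside ∷ p) (suc x) x∉p = ∣p∪⁅x⁆∣≡1+∣p∣ p x (λ x∈p → x∉p (there x∈p))
∣p∪⁅x⁆∣≡1+∣p∣ (inside  ∷ p) (suc x) x∉p = cong suc (∣p∪⁅x⁆∣≡1+∣p∣ p x (λ x∈p → x∉p (there x∈p)))

p⊈q⇒∃∈p∉q : ∀ {n} {p q : Subset n} → p ⊈ q → ∃ λ x → x ∈ p × x ∉ q
p⊈q⇒∃∈p∉q {p = p} {q} p⊈q with any? (λ x → x ∈? p ×-dec ¬? (x ∈? q))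
... | yes witness = witness
... | no none = ⊥-elim (p⊈q λ {x} x∈p → decidable-stable (x ∈? q) (λ x∉q → none (x , x∈p , x∉q)))

p⊆q∧q⊈p⇒p⊂q : ∀ {n} {p q : Subset n} → p ⊆ q → q ⊈ p → p ⊂ q
p⊆q∧q⊈p⇒p⊂q p⊆q q⊈p = p⊆q , p⊈q⇒∃∈p∉q q⊈p

p⊆q∧∣p∣≡∣q∣⇒p≡q : ∀ {n} {p q : Subset n} → p ⊆ q → ∣ p ∣ ≡ ∣ q ∣ → p ≡ q
p⊆q∧∣p∣≡∣q∣⇒p≡q {p = p} {q} p⊆q ∣p∣≡∣q∣ with q ⊆? p
... | yes q⊆p = ⊆-antisym p⊆q q⊆p
... | no q⊈p = ⊥-elim (<-irrefl ∣p∣≡∣q∣ (p⊂q⇒∣p∣<∣q∣ (p⊆q∧q⊈p⇒p⊂q p⊆q q⊈p)))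

x∈p∪⁅y⁆⁻ : ∀ {n} (p : Subset n) (y : Fin n) {x} → x ∈ p ∪ ⁅ y ⁆ → x ∈ p ⊎ x ≡ y
x∈p∪⁅y⁆⁻ p y x∈ = map₂ (x∈⁅y⁆⇒x≡y y) (x∈p∪q⁻ p ⁅ y ⁆ x∈)

x∈p∪⁅x⁆ : ∀ {n} (p : Subset n) (x : Fin n) → x ∈ p ∪ ⁅ x ⁆
x∈p∪⁅x⁆ p x = q⊆p∪q p ⁅ x ⁆ (x∈⁅x⁆ x)

p-x⊆q⇒p⊆q∪⁅x⁆ : ∀ {n} {p q : Subset n} {x} → p - x ⊆ q → p ⊆ q ∪ ⁅ x ⁆
p-x⊆q⇒p⊆q∪⁅x⁆ {q = q} {x} p-x⊆q {y} y∈p with y ≟ x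
... | yes refl = x∈p∪⁅x⁆ q x
... | no y≢x = p⊆p∪q ⁅ x ⁆ (p-x⊆q (x∈p∧x≢y⇒x∈p-y y∈p y≢x))

x∈p⇒p∪⁅x⁆⊆p : ∀ {n} {p : Subset n} {x} → x ∈ p → p ∪ ⁅ x ⁆ ⊆ p
x∈p⇒p∪⁅x⁆⊆p {p = p} {x} x∈p y∈ with x∈p∪⁅y⁆⁻ p x y∈
... | inj₁ y∈p = y∈p
... | inj₂ refl = x∈p

Within : ∀ {n} → (Fin n → Set) → Subset n → Set
Within S X = ∀ e → e ∈ X → S e

within-∪⁅⁆ : ∀ {n} {S : Fin n → Set} {X x} → Within S X → S x → Within S (X ∪ ⁅ x ⁆)
within-∪⁅⁆ {X = X} {x} sX sx e e∈ with x∈p∪⁅y⁆⁻ X x e∈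
... | inj₁ e∈X = sX e e∈X
... | inj₂ refl = sx

within? : ∀ {n} {S : Fin n → Set} → (∀ e → Dec (S e)) → ∀ X → Dec (Within S X)
within? S? X = all? (λ e → e ∈? X →-dec S? e)

within-∅ : ∀ {n} {S : Fin n → Set} → Within S ∅
within-∅ e e∈∅ = ⊥-elim (∉⊥ e∈∅)

module _ {n : ℕ} (Fe : Family n) where

  ∼-refl : ∀ X → _∼_ Fe X X
  ∼-refl X x = (λ Γx → Γx) , (λ Γx → Γx)

  ∼-sym : ∀ {X Y} → _∼_ Fe X Y → _∼_ Fe Y X
  ∼-sym X∼Y x = proj₂ (X∼Y x) , proj₁ (X∼Y x)

  ∼-trans : ∀ {X Y Z} → _∼_ Fe X Y → _∼_ Fe Y Z → _∼_ Fe X Z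
  ∼-trans X∼Y Y∼Z x = (λ Γx → proj₁ (Y∼Z x) (proj₁ (X∼Y x) Γx)) , (λ Γx → proj₂ (X∼Y x) (proj₂ (Y∼Z x) Γx))

  Γ-ξ-disjoint : ∀ {X e} → Γ Fe X e → ¬ ξ Fe X e
  Γ-ξ-disjoint {e = e} Γe (X' , _ , X'∼X , e∈X') = proj₁ (proj₂ (X'∼X e) Γe) e∈X'

  ξ-resp-∼ : ∀ {X X₁ e} → _∼_ Fe X₁ X → ξ Fe X e → ξ Fe X₁ e
  ξ-resp-∼ X₁∼X (X' , fX' , X'∼X , e∈X') = X' , fX' , ∼-trans X'∼X (∼-sym X₁∼X) , e∈X'

  InsideClassOf : Subset n → Subset n → Set
  InsideClassOf Y X = Σ (Subset n) λ Z → Fe Z × _∼_ Fe Z X × Y ⊆ Z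

  Accessible : Set
  Accessible = ∀ X → Fe X → Nonempty X → Σ (Fin n) λ x → x ∈ X × Fe (X - x)

  Exchange : Set
  Exchange = ∀ X Y → Fe X → Fe Y → ∣ Y ∣ < ∣ X ∣ → Σ (Fin n) λ x → x ∈ X × x ∉ Y × Fe (Y ∪ ⁅ x ⁆)

  accessible⇒∅-feasible : Accessible → ∀ X → Fe X → Fe ∅
  accessible⇒∅-feasible accessible X = go X (⊂-wellFounded X)
    where
    go : ∀ X → Acc _⊂_ X → Fe X → Fe ∅
    go X (acc rs) fX with nonempty? X
    ... | no empty = subst Fe (Empty-unique empty) fX
    ... | yes ne with accessible X fX ne
    ...   | x , x∈X , fX-x = go (X - x) (rs (x∈p⇒p-x⊂p x∈X)) fX-x

restrictFam-exchange : ∀ {n} {Fe : Family n} (W : Fin n → Set) → Exchange Fe → Exchange (restrictFam Fe W)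
restrictFam-exchange W exchange X Y (fX , wX) (fY , wY) ∣Y∣<∣X∣ with exchange X Y fX fY ∣Y∣<∣X∣
... | x , x∈X , x∉Y , fYx = x , x∈X , x∉Y , fYx , within-∪⁅⁆ wY (wX x x∈X)

module ExchangeFamily {n : ℕ} (Fe : Family n) (Fe? : ∀ X → Dec (Fe X)) (exchange : Exchange Fe) where

  Γ? : ∀ X x → Dec (Γ Fe X x)
  Γ? X x = ¬? (x ∈? X) ×-dec Fe? (X ∪ ⁅ x ⁆)

  ∼? : ∀ X Y → Dec (_∼_ Fe X Y)
  ∼? X Y = all? λ x → (Γ? X x →-dec Γ? Y x) ×-dec (Γ? Y x →-dec Γ? X x)

  ξ? : ∀ X e → Dec (ξ Fe X e)
  ξ? X e = anySubset? λ X' → Fe? X' ×-dec ∼? X' X ×-dec (e ∈? X')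

  augment : ∀ {X Y} → Fe X → Fe Y → ∣ Y ∣ ≤ ∣ X ∣ →
            Σ (Subset n) λ Z → Fe Z × Y ⊆ Z × Z ⊆ Y ∪ X × ∣ Z ∣ ≡ ∣ X ∣
  augment {X} {Y} fX fY ∣Y∣≤∣X∣ = go (∣ X ∣ ∸ ∣ Y ∣) Y fY (m+[n∸m]≡n ∣Y∣≤∣X∣) (λ y∈Y → y∈Y) (p⊆p∪q X)
    where
    go : ∀ k Y' → Fe Y' → ∣ Y' ∣ + k ≡ ∣ X ∣ → Y ⊆ Y' → Y' ⊆ Y ∪ X →
         Σ (Subset n) λ Z → Fe Z × Y ⊆ Z × Z ⊆ Y ∪ X × ∣ Z ∣ ≡ ∣ X ∣
    go zero Y' fY' ∣Y'∣≡∣X∣ Y⊆Y' Y'⊆Y∪X = Y' , fY' , Y⊆Y' , Y'⊆Y∪X , trans (sym (+-identityʳ _)) ∣Y'∣≡∣X∣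
    go (suc k) Y' fY' ∣Y'∣+1+k≡∣X∣ Y⊆Y' Y'⊆Y∪X
      with exchange X Y' fX fY' (subst (∣ Y' ∣ <_) ∣Y'∣+1+k≡∣X∣ (m<m+n ∣ Y' ∣ (s≤s z≤n)))
    ... | x , x∈X , x∉Y' , fY'x =
      go k (Y' ∪ ⁅ x ⁆) fY'x
         (trans (cong (_+ k) (∣p∪⁅x⁆∣≡1+∣p∣ Y' x x∉Y')) (trans (sym (+-suc ∣ Y' ∣ k)) ∣Y'∣+1+k≡∣X∣))
         (λ y∈Y → p⊆p∪q ⁅ x ⁆ (Y⊆Y' y∈Y)) Y'∪x⊆Y∪X
      where
      Y'∪x⊆Y∪X : Y' ∪ ⁅ x ⁆ ⊆ Y ∪ X
      Y'∪x⊆Y∪X e∈ with x∈p∪⁅y⁆⁻ Y' x e∈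
      ... | inj₁ e∈Y' = Y'⊆Y∪X e∈Y'
      ... | inj₂ refl = q⊆p∪q Y X x∈X

  ∪⁅⁆-exchange≡ : ∀ {X Z : Subset n} {w e} → Z ⊆ X ∪ ⁅ w ⁆ → ∣ Z ∣ ≡ ∣ X ∣ → w ∉ X → e ∉ Z → e ∈ X →
                  Z ∪ ⁅ e ⁆ ≡ X ∪ ⁅ w ⁆
  ∪⁅⁆-exchange≡ {X} {Z} {w} {e} Z⊆X∪w ∣Z∣≡∣X∣ w∉X e∉Z e∈X =
    p⊆q∧∣p∣≡∣q∣⇒p≡q Z∪e⊆X∪w
      (trans (∣p∪⁅x⁆∣≡1+∣p∣ Z e e∉Z) (trans (cong suc ∣Z∣≡∣X∣) (sym (∣p∪⁅x⁆∣≡1+∣p∣ X w w∉X))))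
    where
    Z∪e⊆X∪w : Z ∪ ⁅ e ⁆ ⊆ X ∪ ⁅ w ⁆
    Z∪e⊆X∪w a∈ with x∈p∪⁅y⁆⁻ Z e a∈
    ... | inj₁ a∈Z = Z⊆X∪w a∈Z
    ... | inj₂ refl = p⊆p∪q ⁅ w ⁆ e∈X

  same-size⊆∪⁅⁆⇒∼ : ∀ {X Z w} → Fe X → Fe Z → w ∉ X → ¬ Fe (X ∪ ⁅ w ⁆) →
                    Z ⊆ X ∪ ⁅ w ⁆ → ∣ Z ∣ ≡ ∣ X ∣ → _∼_ Fe Z X
  same-size⊆∪⁅⁆⇒∼ {X} {Z} {w} fX fZ w∉X X∪w-infeasible Z⊆X∪w ∣Z∣≡∣X∣ y = ΓZ⇒ΓX , ΓX⇒ΓZ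
    where
    ∣X∣<∣Z∪y∣ : ∀ {y} → y ∉ Z → ∣ X ∣ < ∣ Z ∪ ⁅ y ⁆ ∣
    ∣X∣<∣Z∪y∣ {y} y∉Z = subst (∣ X ∣ <_) (sym (trans (∣p∪⁅x⁆∣≡1+∣p∣ Z y y∉Z) (cong suc ∣Z∣≡∣X∣))) (n<1+n _)

    ∣Z∣<∣X∪y∣ : ∀ {y} → y ∉ X → ∣ Z ∣ < ∣ X ∪ ⁅ y ⁆ ∣
    ∣Z∣<∣X∪y∣ {y} y∉X = subst (∣ Z ∣ <_) (sym (trans (∣p∪⁅x⁆∣≡1+∣p∣ X y y∉X) (cong suc (sym ∣Z∣≡∣X∣)))) (n<1+n _)

    Z∪e-infeasible : ∀ {e} → e ∉ Z → e ∈ X → ¬ Fe (Z ∪ ⁅ e ⁆)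
    Z∪e-infeasible e∉Z e∈X fZe = X∪w-infeasible (subst Fe (∪⁅⁆-exchange≡ Z⊆X∪w ∣Z∣≡∣X∣ w∉X e∉Z e∈X) fZe)

    ΓZ⇒ΓX : Γ Fe Z y → Γ Fe X y
    ΓZ⇒ΓX (y∉Z , fZy) with y ∈? X
    ... | yes y∈X = ⊥-elim (Z∪e-infeasible y∉Z y∈X fZy)
    ... | no y∉X with exchange (Z ∪ ⁅ y ⁆) X fZy fX (∣X∣<∣Z∪y∣ y∉Z)
    ...   | z , z∈Z∪y , z∉X , fXz with x∈p∪⁅y⁆⁻ Z y z∈Z∪y
    ...     | inj₂ refl = y∉X , fXz
    ...     | inj₁ z∈Z with x∈p∪⁅y⁆⁻ X w (Z⊆X∪w z∈Z)
    ...       | inj₁ z∈X = ⊥-elim (z∉X z∈X)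
    ...       | inj₂ refl = ⊥-elim (X∪w-infeasible fXz)

    ΓX⇒ΓZ : Γ Fe X y → Γ Fe Z y
    ΓX⇒ΓZ (y∉X , fXy) = y∉Z , fZy
      where
      y∉Z : y ∉ Z
      y∉Z y∈Z with x∈p∪⁅y⁆⁻ X w (Z⊆X∪w y∈Z)
      ... | inj₁ y∈X = y∉X y∈X
      ... | inj₂ refl = X∪w-infeasible fXy

      fZy : Fe (Z ∪ ⁅ y ⁆)
      fZy with exchange (X ∪ ⁅ y ⁆) Z fXy fZ (∣Z∣<∣X∪y∣ y∉X)
      ... | z , z∈X∪y , z∉Z , fZz with x∈p∪⁅y⁆⁻ X y z∈X∪y
      ...   | inj₂ refl = fZz
      ...   | inj₁ z∈X = ⊥-elim (Z∪e-infeasible z∉Z z∈X fZz)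

  ⊆∪⁅⁆⇒insideClass : ∀ {X Y w} → Fe X → Fe Y → w ∉ X → ¬ Fe (X ∪ ⁅ w ⁆) → Y ⊆ X ∪ ⁅ w ⁆ → InsideClassOf Fe Y X
  ⊆∪⁅⁆⇒insideClass {X} {Y} {w} fX fY w∉X X∪w-infeasible Y⊆X∪w with augment fX fY ∣Y∣≤∣X∣
    where
    ∣Y∣≤∣X∣ : ∣ Y ∣ ≤ ∣ X ∣
    ∣Y∣≤∣X∣ with ∣ X ∣ <? ∣ Y ∣
    ... | no ∣X∣≮∣Y∣ = ≮⇒≥ ∣X∣≮∣Y∣
    ... | yes ∣X∣<∣Y∣ with exchange Y X fY fX ∣X∣<∣Y∣
    ...   | z , z∈Y , z∉X , fXz with x∈p∪⁅y⁆⁻ X w (Y⊆X∪w z∈Y)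
    ...     | inj₁ z∈X = ⊥-elim (z∉X z∈X)
    ...     | inj₂ refl = ⊥-elim (X∪w-infeasible fXz)
  ... | Z , fZ , Y⊆Z , Z⊆Y∪X , ∣Z∣≡∣X∣ =
    Z , fZ , same-size⊆∪⁅⁆⇒∼ fX fZ w∉X X∪w-infeasible Z⊆X∪w ∣Z∣≡∣X∣ , Y⊆Z
    where
    Z⊆X∪w : Z ⊆ X ∪ ⁅ w ⁆
    Z⊆X∪w e∈Z with x∈p∪q⁻ Y X (Z⊆Y∪X e∈Z)
    ... | inj₁ e∈Y = Y⊆X∪w e∈Y
    ... | inj₂ e∈X = p⊆p∪q ⁅ w ⁆ e∈X

  singleton⇒Γ⊎ξ : ∀ {X w} → Fe X → Fe ⁅ w ⁆ → Γ Fe X w ⊎ ξ Fe X w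
  singleton⇒Γ⊎ξ {X} {w} fX fw with w ∈? X
  ... | yes w∈X = inj₂ (X , fX , ∼-refl Fe X , w∈X)
  ... | no w∉X with Fe? (X ∪ ⁅ w ⁆)
  ...   | yes fXw = inj₁ (w∉X , fXw)
  ...   | no X∪w-infeasible with ⊆∪⁅⁆⇒insideClass fX fw w∉X X∪w-infeasible (q⊆p∪q X ⁅ w ⁆)
  ...     | Z , fZ , Z∼X , w⊆Z = inj₂ (Z , fZ , Z∼X , w⊆Z (x∈⁅x⁆ w))

  -- Peel Y along accessibility; each re-added element lies in ξ(X), so it cannot extend the
  -- current member of the class and is absorbed into an equivalent one.
  ⊆ξ⇒insideClass : Accessible Fe → ∀ {X} → Fe X → ∀ Y → Fe Y → Within (ξ Fe X) Y → InsideClassOf Fe Y X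
  ⊆ξ⇒insideClass accessible {X} fX Y = go Y (⊂-wellFounded Y)
    where
    go : ∀ Y → Acc _⊂_ Y → Fe Y → Within (ξ Fe X) Y → InsideClassOf Fe Y X
    go Y (acc rs) fY Y⊆ξX with nonempty? Y
    ... | no empty = X , fX , ∼-refl Fe X , λ e∈Y → ⊥-elim (empty (_ , e∈Y))
    ... | yes ne with accessible Y fY ne
    ...   | y , y∈Y , fY-y with go (Y - y) (rs (x∈p⇒p-x⊂p y∈Y)) fY-y (λ e e∈ → Y⊆ξX e (p─q⊆p Y ⁅ y ⁆ e∈))
    ...     | X₁ , fX₁ , X₁∼X , Y-y⊆X₁ with y ∈? X₁
    ...       | yes y∈X₁ = X₁ , fX₁ , X₁∼X , λ e∈Y → x∈p⇒p∪⁅x⁆⊆p y∈X₁ (p-x⊆q⇒p⊆q∪⁅x⁆ Y-y⊆X₁ e∈Y)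
    ...       | no y∉X₁ with ⊆∪⁅⁆⇒insideClass fX₁ fY y∉X₁ X₁∪y-infeasible (p-x⊆q⇒p⊆q∪⁅x⁆ Y-y⊆X₁)
      where
      X₁∪y-infeasible : ¬ Fe (X₁ ∪ ⁅ y ⁆)
      X₁∪y-infeasible fX₁y = Γ-ξ-disjoint Fe (y∉X₁ , fX₁y) (ξ-resp-∼ Fe X₁∼X (Y⊆ξX y y∈Y))
    ...         | Z , fZ , Z∼X₁ , Y⊆Z = Z , fZ , ∼-trans Fe Z∼X₁ X₁∼X , Y⊆Z

  maximal-feasible : ∀ (S : Fin n → Set) → (∀ e → Dec (S e)) → ∀ X → Fe X → Within S X → Σ (Subset n) (MaxIn Fe S)
  maximal-feasible S S? X = go X (⊃-wellFounded X)
    where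
    go : ∀ X → Acc _⊃_ X → Fe X → Within S X → Σ (Subset n) (MaxIn Fe S)
    go X (acc rs) fX sX with anySubset? {P = λ Y → Fe Y × X ⊂ Y × Within S Y} (λ Y → Fe? Y ×-dec X ⊂? Y ×-dec within? S? Y)
    ... | yes (Y , fY , X⊂Y , sY) = go Y (rs X⊂Y) fY sY
    ... | no none = X , fX , sX , λ Y fY X⊆Y sY →
      decidable-stable (Y ⊆? X) λ Y⊈X → none (Y , fY , p⊆q∧q⊈p⇒p⊂q X⊆Y Y⊈X , sY)

  covector≢one : ∀ {α X w} → IsCovector Fe α X → Fe ⁅ w ⁆ → lookup α w ≢ one
  covector≢one {α} {X} {w} (fX , shape) fw with singleton⇒Γ⊎ξ fX fw
  ... | inj₂ ξw = subst (_≢ one) (sym (proj₁ (proj₂ (shape w)) ξw)) (λ ())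
  ... | inj₁ Γw with proj₁ (shape w) Γw
  ...   | inj₁ α≡pos = subst (_≢ one) (sym α≡pos) (λ ())
  ...   | inj₂ α≡neg = subst (_≢ one) (sym α≡neg) (λ ())

OppositeSigns : Sign → Sign → Set
OppositeSigns a b = (a ≡ pos × b ≡ neg) ⊎ (a ≡ neg × b ≡ pos)

toSign3 : (s : Sign) → s ≢ one → Sign3
toSign3 zer _ = zer₃
toSign3 pos _ = pos₃
toSign3 neg _ = neg₃
toSign3 one s≢one = ⊥-elim (s≢one refl)

embed∘toSign3 : ∀ s (s≢one : s ≢ one) → embed (toSign3 s s≢one) ≡ s
embed∘toSign3 zer _ = refl
embed∘toSign3 pos _ = refl
embed∘toSign3 neg _ = refl
embed∘toSign3 one s≢one = ⊥-elim (s≢one refl)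

embed-injective : ∀ {a b} → embed a ≡ embed b → a ≡ b
embed-injective {zer₃} {zer₃} _ = refl
embed-injective {pos₃} {pos₃} _ = refl
embed-injective {neg₃} {neg₃} _ = refl
embed-injective {zer₃} {pos₃} ()
embed-injective {zer₃} {neg₃} ()
embed-injective {pos₃} {zer₃} ()
embed-injective {pos₃} {neg₃} ()
embed-injective {neg₃} {zer₃} ()
embed-injective {neg₃} {pos₃} ()

embed≢one : ∀ s → embed s ≢ one
embed≢one zer₃ ()
embed≢one pos₃ ()
embed≢one neg₃ ()

embed-neg : ∀ s → embed (neg₃ˢ s) ≡ negS (embed s)
embed-neg zer₃ = refl
embed-neg pos₃ = refl
embed-neg neg₃ = refl

embed-comp : ∀ a b → embed (comp₃ a b) ≡ combine (embed a) (embed b)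
embed-comp zer₃ zer₃ = refl
embed-comp zer₃ pos₃ = refl
embed-comp zer₃ neg₃ = refl
embed-comp pos₃ zer₃ = refl
embed-comp pos₃ pos₃ = refl
embed-comp pos₃ neg₃ = refl
embed-comp neg₃ zer₃ = refl
embed-comp neg₃ pos₃ = refl
embed-comp neg₃ neg₃ = refl

opposite₃⇔OppositeSigns : ∀ a b → (a ≡ neg₃ˢ b × a ≢ zer₃) ⇔ OppositeSigns (embed a) (embed b)
opposite₃⇔OppositeSigns a b = mk⇔ (to a b) (from a b)
  where
  to : ∀ a b → a ≡ neg₃ˢ b × a ≢ zer₃ → OppositeSigns (embed a) (embed b)
  to zer₃ _    (_ , a≢0) = ⊥-elim (a≢0 refl)
  to pos₃ neg₃ _ = inj₁ (refl , refl)
  to neg₃ pos₃ _ = inj₂ (refl , refl)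
  to pos₃ zer₃ (() , _)
  to pos₃ pos₃ (() , _)
  to neg₃ zer₃ (() , _)
  to neg₃ neg₃ (() , _)
  from : ∀ a b → OppositeSigns (embed a) (embed b) → a ≡ neg₃ˢ b × a ≢ zer₃
  from pos₃ neg₃ _ = refl , λ ()
  from neg₃ pos₃ _ = refl , λ ()
  from zer₃ _    (inj₁ (() , _))
  from zer₃ _    (inj₂ (() , _))
  from pos₃ _    (inj₂ (() , _))
  from neg₃ _    (inj₁ (() , _))
  from pos₃ zer₃ (inj₁ (_ , ()))
  from pos₃ pos₃ (inj₁ (_ , ()))
  from neg₃ zer₃ (inj₂ (_ , ()))
  from neg₃ neg₃ (inj₂ (_ , ()))

oneUnless : ∀ {P : Set} → Dec P → Sign → Sign
oneUnless (yes _) a = a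
oneUnless (no _)  _ = one

oneUnless-yes : ∀ {P : Set} (d : Dec P) a → P → oneUnless d a ≡ a
oneUnless-yes (yes _) a _ = refl
oneUnless-yes (no ¬p) a p = ⊥-elim (¬p p)

oneUnless-no : ∀ {P : Set} (d : Dec P) a → ¬ P → oneUnless d a ≡ one
oneUnless-no (yes p) a ¬p = ⊥-elim (¬p p)
oneUnless-no (no _)  a _  = refl

module RestrictionToΓ∅ {n : ℕ} (F : Subset n → Bool) (greedoid : IsIntervalGreedoid (λ X → T (F X))) where

  Fe : Family n
  Fe X = T (F X)

  W : Fin n → Set
  W = Γ∅ Fe

  Fe↾W : Family n
  Fe↾W = restrictFam Fe W

  Fe? : ∀ X → Dec (Fe X)
  Fe? X = T? (F X)

  Fe↾W? : ∀ X → Dec (Fe↾W X)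
  Fe↾W? X = Fe? X ×-dec within? (λ e → Fe? ⁅ e ⁆) X

  private
    accessible : Accessible Fe
    accessible = proj₁ (proj₂ greedoid)

    exchange : Exchange Fe
    exchange = proj₁ (proj₂ (proj₂ greedoid))

    interval : ∀ X Y Z e → Fe X → Fe Y → Fe Z → X ⊆ Y → Y ⊆ Z → e ∉ Z →
               Fe (X ∪ ⁅ e ⁆) → Fe (Z ∪ ⁅ e ⁆) → Fe (Y ∪ ⁅ e ⁆)
    interval = proj₂ (proj₂ (proj₂ greedoid))

  module G = ExchangeFamily Fe Fe? exchange
  module G↾W = ExchangeFamily Fe↾W Fe↾W? (restrictFam-exchange W exchange)

  ∅-feasible : Fe ∅
  ∅-feasible = accessible⇒∅-feasible Fe accessible _ (proj₂ (proj₁ greedoid))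

  ∅-feasible↾W : Fe↾W ∅
  ∅-feasible↾W = ∅-feasible , within-∅

  ⁅w⁆-feasible↾W : ∀ {w} → W w → Fe↾W ⁅ w ⁆
  ⁅w⁆-feasible↾W {w} ww = ww , λ e e∈⁅w⁆ → subst W (sym (x∈⁅y⁆⇒x≡y w e∈⁅w⁆)) ww

  Γ⇒Γ↾W : ∀ {X Y w} → Fe X → Fe Y → Within (λ e → W e × ξ Fe X e) Y → W w → Γ Fe X w → Γ Fe↾W Y w
  Γ⇒Γ↾W {X} {Y} {w} fX fY Y⊆W∩ξX ww ΓXw
    with G.⊆ξ⇒insideClass accessible fX Y fY (λ e e∈Y → proj₂ (Y⊆W∩ξX e e∈Y))
  ... | X' , fX' , X'∼X , Y⊆X' = w∉Y , fYw , within-∪⁅⁆ (λ e e∈Y → proj₁ (Y⊆W∩ξX e e∈Y)) ww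
    where
    ΓX'w : Γ Fe X' w
    ΓX'w = proj₂ (X'∼X w) ΓXw

    w∉Y : w ∉ Y
    w∉Y w∈Y = Γ-ξ-disjoint Fe ΓXw (proj₂ (Y⊆W∩ξX w w∈Y))

    fYw : Fe (Y ∪ ⁅ w ⁆)
    fYw = interval ∅ Y X' w ∅-feasible fY fX' ⊥⊆ Y⊆X' (proj₁ ΓX'w)
            (subst Fe (sym (∪-identityˡ ⁅ w ⁆)) ww) (proj₂ ΓX'w)

  ξ↾W⇒ξ : ∀ {X Y w} → Fe X → Fe Y → Within (λ e → W e × ξ Fe X e) Y → W w → ξ Fe↾W Y w → ξ Fe X w
  ξ↾W⇒ξ fX fY Y⊆W∩ξX ww ξ↾W with G.singleton⇒Γ⊎ξ fX ww
  ... | inj₂ ξXw = ξXw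
  ... | inj₁ ΓXw = ⊥-elim (Γ-ξ-disjoint Fe↾W (Γ⇒Γ↾W fX fY Y⊆W∩ξX ww ΓXw) ξ↾W)

module OrientedRestriction {n : ℕ} (F : Subset n → Bool) (L : Vec Sign n → Set)
  (oriented : IsOrientedIntervalGreedoid (λ X → T (F X)) L) where

  open IsOrientedIntervalGreedoid oriented
  open RestrictionToΓ∅ F greedoid

  res⇒restr : ∀ r → ResSet Fe W L r → RestrSet Fe W L r
  res⇒restr r (α , Lα , X , Y , (fX , shape) , (fY↾W@(fY , _) , Y⊆W∩ξX , _) , r-shape) = α , Lα , r≡α
    where
    r≡α : ∀ w → r w ≡ lookup α (proj₁ w)
    r≡α (w , ww) with G↾W.singleton⇒Γ⊎ξ fY↾W (⁅w⁆-feasible↾W ww)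
    ... | inj₁ Γ↾W = proj₁ (proj₂ (r-shape (w , ww))) Γ↾W
    ... | inj₂ ξ↾W = trans (proj₁ (r-shape (w , ww)) ξ↾W)
                           (sym (proj₁ (proj₂ (shape w)) (ξ↾W⇒ξ fX fY Y⊆W∩ξX ww ξ↾W)))

  restr⇒res : ∀ r → RestrSet Fe W L r → ResSet Fe W L r
  restr⇒res r (α , Lα , r≡α) with covec α Lα
  ... | X , (fX , shape)
    with G↾W.maximal-feasible (λ e → W e × ξ Fe X e) (λ e → Fe? ⁅ e ⁆ ×-dec G.ξ? X e) ∅ ∅-feasible↾W within-∅
  ...   | Y , Y-max@(fY↾W@(fY , _) , Y⊆W∩ξX , _) = α , Lα , X , Y , (fX , shape) , Y-max , r-shape
    where
    r-shape : ∀ w → (ξ Fe↾W Y (proj₁ w) → r w ≡ zer)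
                  × (Γ Fe↾W Y (proj₁ w) → r w ≡ lookup α (proj₁ w))
                  × (¬ ξ Fe↾W Y (proj₁ w) → ¬ Γ Fe↾W Y (proj₁ w) → r w ≡ one)
    r-shape (w , ww) =
        (λ ξ↾W → trans (r≡α (w , ww)) (proj₁ (proj₂ (shape w)) (ξ↾W⇒ξ fX fY Y⊆W∩ξX ww ξ↾W)))
      , (λ _ → r≡α (w , ww))
      , λ ¬ξ↾W ¬Γ↾W → ⊥-elim ([ ¬Γ↾W , ¬ξ↾W ] (G↾W.singleton⇒Γ⊎ξ fY↾W (⁅w⁆-feasible↾W ww)))

  res≢one : ∀ r → ResSet Fe W L r → ∀ w → r w ≢ one
  res≢one r R w with res⇒restr r R
  ... | α , Lα , r≡α = subst (_≢ one) (sym (r≡α w)) (G.covector≢one {α} (proj₂ (covec α Lα)) (proj₂ w))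

  ProductOnW : Vec Sign n → Vec Sign n → Set
  ProductOnW α β = Σ (Vec Sign n) λ p → L p × IsProduct Fe α β p ×
                     (∀ w → W w → lookup p w ≡ combine (lookup α w) (lookup β w))

  product-on-W : ∀ {α β} → L α → L β → ProductOnW α β
  product-on-W {α} {β} Lα Lβ with covec α Lα | covec β Lβ
  ... | X , α-covector | Y , β-covector
    with G.maximal-feasible (λ e → ξ Fe X e × ξ Fe Y e) (λ e → G.ξ? X e ×-dec G.ξ? Y e) ∅ ∅-feasible within-∅
  ...   | Z , Z-max@(fZ , _) = p , OG3 α β p Lα Lβ p-product , p-product , p-on-W
    where
    C? : ∀ e → Dec (Γ Fe Z e ⊎ ξ Fe Z e)
    C? e = G.Γ? Z e ⊎-dec G.ξ? Z e

    αβ : Fin n → Sign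
    αβ e = combine (lookup α e) (lookup β e)

    p : Vec Sign n
    p = tabulate λ e → oneUnless (C? e) (αβ e)

    p-product : IsProduct Fe α β p
    p-product = X , Y , Z , α-covector , β-covector , Z-max , λ e →
        (λ Ce → trans (lookup∘tabulate _ e) (oneUnless-yes (C? e) (αβ e) Ce))
      , (λ ¬Ce → trans (lookup∘tabulate _ e) (oneUnless-no (C? e) (αβ e) ¬Ce))

    p-on-W : ∀ w → W w → lookup p w ≡ αβ w
    p-on-W w ww = trans (lookup∘tabulate _ w) (oneUnless-yes (C? w) (αβ w) (G.singleton⇒Γ⊎ξ fZ ww))

  Res₃ : (Σ (Fin n) W → Sign3) → Set
  Res₃ γ = ResSet Fe W L (λ w → embed (γ w))

  Restricts : (Σ (Fin n) W → Sign3) → Vec Sign n → Set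
  Restricts γ α = ∀ w → embed (γ w) ≡ lookup α (proj₁ w)

  comp₃-restricts : ∀ {γ δ α β p} → Restricts γ α → Restricts δ β →
                    (∀ w → W w → lookup p w ≡ combine (lookup α w) (lookup β w)) →
                    Restricts (λ w → comp₃ (γ w) (δ w)) p
  comp₃-restricts {γ} {δ} {α} {β} {p} γ↾α δ↾β p-on-W w =
    trans (embed-comp (γ w) (δ w)) (trans (cong₂ combine (γ↾α w) (δ↾β w)) (sym (p-on-W (proj₁ w) (proj₂ w))))

  -- A maximal feasible X has Γ(X) = ∅, so W ⊆ ξ(X) and the covector of X vanishes on W.
  zero∈Res₃ : Res₃ (λ _ → zer₃)
  zero∈Res₃ with G.maximal-feasible (λ _ → ⊤) (λ _ → yes tt) ∅ ∅-feasible (λ _ _ → tt)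
  ... | X , fX , _ , X-max with OG1 X fX
  ...   | α , Lα , (_ , shape) = restr⇒res _ (α , Lα , λ (w , ww) → sym (proj₁ (proj₂ (shape w)) (ξXw ww)))
    where
    ξXw : ∀ {w} → W w → ξ Fe X w
    ξXw {w} ww with G.singleton⇒Γ⊎ξ fX ww
    ... | inj₂ ξXw = ξXw
    ... | inj₁ (w∉X , fXw) = ⊥-elim (w∉X (X-max (X ∪ ⁅ w ⁆) fXw (p⊆p∪q ⁅ w ⁆) (λ _ _ → tt) (x∈p∪⁅x⁆ X w)))

  neg∈Res₃ : ∀ γ → Res₃ γ → Res₃ (λ w → neg₃ˢ (γ w))
  neg∈Res₃ γ Rγ with res⇒restr _ Rγ
  ... | α , Lα , γ↾α = restr⇒res _ (map negS α , OG2 α Lα , -γ↾-α)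
    where
    open ≡-Reasoning
    -γ↾-α : Restricts (λ w → neg₃ˢ (γ w)) (map negS α)
    -γ↾-α w = begin
      embed (neg₃ˢ (γ w))       ≡⟨ embed-neg (γ w) ⟩
      negS (embed (γ w))        ≡⟨ cong negS (γ↾α w) ⟩
      negS (lookup α (proj₁ w)) ≡⟨ sym (lookup-map (proj₁ w) negS α) ⟩
      lookup (map negS α) (proj₁ w) ∎

  comp∈Res₃ : ∀ γ δ → Res₃ γ → Res₃ δ → Res₃ (λ w → comp₃ (γ w) (δ w))
  comp∈Res₃ γ δ Rγ Rδ with res⇒restr _ Rγ | res⇒restr _ Rδ
  ... | α , Lα , γ↾α | β , Lβ , δ↾β = from-product (product-on-W Lα Lβ)
    where
    from-product : ProductOnW α β → Res₃ (λ w → comp₃ (γ w) (δ w))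
    from-product (p , Lp , _ , p-on-W) = restr⇒res _ (p , Lp , comp₃-restricts {γ} {δ} {α} {β} {p} γ↾α δ↾β p-on-W)

  Elimination : (γ δ : Σ (Fin n) W → Sign3) → Σ (Fin n) W → Set
  Elimination γ δ e = Σ (Σ (Fin n) W → Sign3) λ ε → Res₃ ε × ε e ≡ zer₃ ×
    (∀ f → ¬ Sep₃ γ δ f → ε f ≡ comp₃ (γ f) (δ f) × ε f ≡ comp₃ (δ f) (γ f))

  eliminate : ∀ {γ δ α β} e → L α → L β → Restricts γ α → Restricts δ β → Sep₃ γ δ e → Elimination γ δ e
  eliminate {γ} {δ} {α} {β} e Lα Lβ γ↾α δ↾β γδ-sep-e = from-products (product-on-W Lα Lβ) (product-on-W Lβ Lα)
    where
    sep⇒Sep : ∀ w → Sep₃ γ δ w → Sep Fe α β (proj₁ w)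
    sep⇒Sep w = subst₂ OppositeSigns (γ↾α w) (δ↾β w) ∘ Equivalence.to (opposite₃⇔OppositeSigns (γ w) (δ w))

    Sep⇒sep : ∀ w → Sep Fe α β (proj₁ w) → Sep₃ γ δ w
    Sep⇒sep w = Equivalence.from (opposite₃⇔OppositeSigns (γ w) (δ w)) ∘ subst₂ OppositeSigns (sym (γ↾α w)) (sym (δ↾β w))

    from-products : ProductOnW α β → ProductOnW β α → Elimination γ δ e
    from-products (p , _ , p-product , p-on-W) (q , _ , q-product , q-on-W) =
      from-OG4 (OG4 α β p q (proj₁ e) Lα Lβ p-product q-product (sep⇒Sep e γδ-sep-e) (p≢one e))
      where
      p↾ : Restricts (λ w → comp₃ (γ w) (δ w)) p
      p↾ = comp₃-restricts {γ} {δ} {α} {β} {p} γ↾α δ↾β p-on-W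

      q↾ : Restricts (λ w → comp₃ (δ w) (γ w)) q
      q↾ = comp₃-restricts {δ} {γ} {β} {α} {q} δ↾β γ↾α q-on-W

      p≢one : ∀ w → lookup p (proj₁ w) ≢ one
      p≢one w = subst (_≢ one) (p↾ w) (embed≢one _)

      from-OG4 : (Σ (Vec Sign n) λ κ → L κ × lookup κ (proj₁ e) ≡ zer ×
                    (∀ y → ¬ Sep Fe α β y → lookup p y ≢ one → lookup κ y ≡ lookup p y × lookup κ y ≡ lookup q y)) →
                 Elimination γ δ e
      from-OG4 (κ , Lκ , κe≡zer , κ-agrees) =
        ε , restr⇒res _ (κ , Lκ , ε↾κ) , embed-injective (trans (ε↾κ e) κe≡zer) , ε-agrees
        where
        ε : Σ (Fin n) W → Sign3
        ε w = toSign3 (lookup κ (proj₁ w)) (G.covector≢one {κ} (proj₂ (covec κ Lκ)) (proj₂ w))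

        ε↾κ : Restricts ε κ
        ε↾κ w = embed∘toSign3 _ _

        ε-agrees : ∀ f → ¬ Sep₃ γ δ f → ε f ≡ comp₃ (γ f) (δ f) × ε f ≡ comp₃ (δ f) (γ f)
        ε-agrees f ¬sep with κ-agrees (proj₁ f) (¬sep ∘ Sep⇒sep f) (p≢one f)
        ... | κ≡p , κ≡q = embed-injective (trans (ε↾κ f) (trans κ≡p (sym (p↾ f))))
                        , embed-injective (trans (ε↾κ f) (trans κ≡q (sym (q↾ f))))

  elim∈Res₃ : ∀ γ δ e → Res₃ γ → Res₃ δ → Sep₃ γ δ e → Elimination γ δ e
  elim∈Res₃ γ δ e Rγ Rδ with res⇒restr _ Rγ | res⇒restr _ Rδ
  ... | α , Lα , γ↾α | β , Lβ , δ↾β = eliminate {γ} {δ} e Lα Lβ γ↾α δ↾β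

  orientedMatroid : IsOrientedMatroid (Σ (Fin n) W) Res₃
  orientedMatroid = record
    { zero∈ = zero∈Res₃
    ; neg∈  = neg∈Res₃
    ; comp∈ = comp∈Res₃
    ; elim  = elim∈Res₃
    }

mainTheorem14 : ∀ {n : ℕ} (F : Subset n → Bool) (L : Vec Sign n → Set) →
    IsOrientedIntervalGreedoid (λ X → T (F X)) L →
    (∀ r → ResSet (λ X → T (F X)) (Γ∅ (λ X → T (F X))) L r →
       RestrSet (λ X → T (F X)) (Γ∅ (λ X → T (F X))) L r)
    × (∀ r → RestrSet (λ X → T (F X)) (Γ∅ (λ X → T (F X))) L r →
       ResSet (λ X → T (F X)) (Γ∅ (λ X → T (F X))) L r)
    × (∀ r → ResSet (λ X → T (F X)) (Γ∅ (λ X → T (F X))) L r → ∀ w → r w ≢ one)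
    × IsOrientedMatroid (Σ (Fin n) (Γ∅ (λ X → T (F X))))
        (λ γ → ResSet (λ X → T (F X)) (Γ∅ (λ X → T (F X))) L (λ w → embed (γ w)))
mainTheorem14 F L oriented = res⇒restr , restr⇒res , res≢one , orientedMatroid
  where open OrientedRestriction F L oriented
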